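{- The mapping $[\mathsf{P}]\mapsto[\mathcal{A}_\mathsf{P}]$ is a well-defined order-embedding from $\big(\mathbb{P}_{\mathrm{lay}},\preccurlyeq_c\big)/\!\equiv_c$ into $\big(\mathbf{\Delta}^0_2(\mathcal{P}\omega),\leq_w\big)/\!\equiv_w$; i.e. for all $\mathsf{P},\mathsf{Q}\in\mathbb{P}_{\mathrm{lay}}$, $\mathcal{A}_\mathsf{P}\in\mathbf{\Delta}^0_2(\mathcal{P}\omega)$, and $\mathsf{P}\preccurlyeq_c\mathsf{Q}$ if and only if $\mathcal{A}_\mathsf{P}\leq_w\mathcal{A}_\mathsf{Q}$ (so in particular $\mathsf{P}\equiv_c\mathsf{Q}$ iff $\mathcal{A}_\mathsf{P}\equiv_w\mathcal{A}_\mathsf{Q}$).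
   Context: Scott domain: $\mathcal{P}\omega$ is the power set of $\omega$ with topology generated by $\mathcal{O}_F=\{x\subseteq\omega\mid F\subseteq x\}$, $F\subseteq\omega$ finite. Borel classes (Selivanov): $\mathbf{\Sigma}^0_1$ = open sets; $\mathbf{\Sigma}^0_2(\mathcal{P}\omega)$ = countable unions of sets $B\setminus B'$ with $B,B'$ open; $\mathbf{\Pi}^0_2$ = complements of $\mathbf{\Sigma}^0_2$ sets; $\mathbf{\Delta}^0_2=\mathbf{\Sigma}^0_2\cap\mathbf{\Pi}^0_2$. $\mathcal{A}\leq_w\mathcal{B}$ iff there is a continuous $f:\mathcal{P}\omega\to\mathcal{P}\omega$ with $f^{ -1}[\mathcal{B}]=\mathcal{A}$; $\equiv_w$ is the induced equivalence, and the quotient is ordered by $[\mathcal{A}]\leq[\mathcal{B}]$ iff $\mathcal{A}\leq_w\mathcal{B}$. 2-colored posets: a triple $\mathsf{P}=(P,\leq_p,\mathrm{col}_p)$ with $\leq_p$ a partial order and $\mathrm{col}_p:P\to\{0,1\}$. A homomorphism $\varphi:\mathsf{P}\to\mathsf{Q}$ is a map with $p\leq_p p'\Rightarrow\varphi(p)\leq_q\varphi(p')$ and $\mathrm{col}_q(\varphi(p))=\mathrm{col}_p(p)$; $\mathsf{P}\preccurlyeq_c\mathsf{Q}$ means such a homomorphism exists, $\equiv_c$ is the induced equivalence, and the quotient is ordered accordingly. $\mathsf{P}\rightarrowtail_c\mathsf{Q}$ means there is an injective homomorphism $\varphi$ which preserves immediate predecessors: if $p_0$ is an immediate predecessor of $p_1$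 (i.e. $p_0<p_1$ with nothing strictly between), then $\varphi(p_0)$ is an immediate predecessor of $\varphi(p_1)$. Shrubs: a countable poset $(P,\leq_p)$ is a shrub if (1) there is no injective order-preserving map from $(\omega,\leq)$ into $P$; (2) every $p\in P$ has finitely many elements $\leq_p p$; (3) there is a $\leq_p$-minimal element, denoted $\bot$; (4) $P$ is bounded complete: every subset having an upper bound has a least upper bound (supremum). $\mathbb{P}_{\mathrm{lay}}$ (embeddable posets) is the class of countable 2-colored posets $\mathsf{P}$ whose underlying poset is a shrub and such that: (a) $\mathrm{col}_p(\bot)=0$; (b) every $\leq_p$-maximal element has color $1$; (c) none of the following 2-colored posets satisfies $\cdot\rightarrowtail_c\mathsf{P}$: $\vee^0_1$ (elements $a<b$, $a<c$, $b,c$ incomparable, $\mathrm{col}(a)=1$, $\mathrm{col}(b)=\mathrm{col}(c)=0$), $\wedge^1_0$ (elements $a<c$, $b<c$, $a,b$ incomparable, $\mathrm{col}(c)=1$, $\mathrm{col}(a)=\mathrm{col}(b)=0$), and $\mid^1_1$ (elements $a<b$, both of color $1$). The set $\mathcal{A}_\mathsf{P}$: identify the underlying set of $\mathsf{P}$ with some $\alpha\in\omega\cup\{\omega\}$ (so elements are natural numbers). Define the labeling $l_p:P\to\mathcal{P}_{<\omega}(\omega)$ by $l_p(\bot)=\emptyset$ and $l_p(n)=\{k\in P\mid k\leq_p n\}$ for $n\neq\bot$. Then $\mathcal{A}_\mathsf{P}=\{l_p(p)\mid p\in P,\ \mathrm{col}_p(p)=1\}\subseteq\mathcal{P}\omega$.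 -}

module Defs where

open import Level using (Level; 0ℓ) renaming (suc to lsuc)
open import Data.Nat using (ℕ)
open import Data.Fin using (Fin; toℕ; zero; suc)
open import Data.Bool using (Bool; true; false)
open import Data.Unit using (⊤; tt)
open import Data.Empty using (⊥)
open import Data.Product using (Σ; ∃; _×_; _,_)
open import Data.List using (List)
open import Data.List.Membership.Propositional using (_∈_)
open import Relation.Nullary using (¬_)
open import Relation.Binary.PropositionalEquality using (_≡_)
open import Relation.Binary.Structures using (IsPartialOrder)
open import Function.Definitions using (Injective)
open import Function.Bundles using (_⇔_)

Pω : Set₁
Pω = ℕ → Set

PSet : Set₂
PSet = Pω → Set₁

_⊆fin_ : List ℕ → Pω → Set
F ⊆fin x = ∀ {k} → k ∈ F → x k

-- Open sets of the Scott topology: unions of basic opens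
-- O_F = {x | F ⊆ x}, F finite.
IsOpen : PSet → Set₁
IsOpen U = Σ (List ℕ → Set) λ 𝓕 → ∀ x → U x ⇔ (∃ λ F → 𝓕 F × (F ⊆fin x))

Continuous : (Pω → Pω) → Set₂
Continuous f = ∀ (U : PSet) → IsOpen U → IsOpen (λ x → U (f x))

Σ⁰₂ : PSet → Set₂
Σ⁰₂ A = Σ (ℕ → PSet) λ B → Σ (ℕ → PSet) λ B' →
          (∀ i → IsOpen (B i)) × (∀ i → IsOpen (B' i)) ×
          (∀ x → A x ⇔ (∃ λ i → B i x × ¬ B' i x))

Π⁰₂ : PSet → Set₂
Π⁰₂ A = Σ⁰₂ (λ x → ¬ A x)

Δ⁰₂ : PSet → Set₂
Δ⁰₂ A = Σ⁰₂ A × Π⁰₂ A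

_≤w_ : PSet → PSet → Set₂
A ≤w B = Σ (Pω → Pω) λ f → Continuous f × (∀ x → A x ⇔ B (f x))

-- 2-colored posets (raw structures; colour true = 1, false = 0)

record CPoset : Set₁ where
  field
    Carrier : Set
    _≤_     : Carrier → Carrier → Set
    col     : Carrier → Bool

module _ (P : CPoset) where
  open CPoset P

  _<_ : Carrier → Carrier → Set
  a < b = a ≤ b × ¬ (a ≡ b)

  ImmPred : Carrier → Carrier → Set
  ImmPred a b = a < b × ¬ (∃ λ r → a < r × r < b)

IsHom : (P Q : CPoset) → (CPoset.Carrier P → CPoset.Carrier Q) → Set
IsHom P Q φ = (∀ {p p'} → CPoset._≤_ P p p' → CPoset._≤_ Q (φ p) (φ p'))
            × (∀ p → CPoset.col Q (φ p) ≡ CPoset.col P p)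

_≼c_ : CPoset → CPoset → Set
P ≼c Q = Σ (CPoset.Carrier P → CPoset.Carrier Q) (IsHom P Q)

_↣c_ : CPoset → CPoset → Set
P ↣c Q = Σ (CPoset.Carrier P → CPoset.Carrier Q) λ φ →
           IsHom P Q φ × Injective _≡_ _≡_ φ ×
           (∀ {p₀ p₁} → ImmPred P p₀ p₁ → ImmPred Q (φ p₀) (φ p₁))

-- The forbidden patterns ∨⁰₁, ∧¹₀, |¹₁  (on Fin 3 / Fin 2, a = 0, b = 1, c = 2)

private
  pattern f0 = zero
  pattern f1 = suc zero
  pattern f2 = suc (suc zero)

vee-≤ : Fin 3 → Fin 3 → Set
vee-≤ f0 _  = ⊤
vee-≤ f1 f1 = ⊤
vee-≤ f2 f2 = ⊤
vee-≤ _  _  = ⊥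

vee-col : Fin 3 → Bool
vee-col f0 = true
vee-col _  = false

Vee⁰₁ : CPoset
Vee⁰₁ = record { Carrier = Fin 3 ; _≤_ = vee-≤ ; col = vee-col }

wedge-≤ : Fin 3 → Fin 3 → Set
wedge-≤ _  f2 = ⊤
wedge-≤ f0 f0 = ⊤
wedge-≤ f1 f1 = ⊤
wedge-≤ _  _  = ⊥

wedge-col : Fin 3 → Bool
wedge-col f2 = true
wedge-col _  = false

Wedge¹₀ : CPoset
Wedge¹₀ = record { Carrier = Fin 3 ; _≤_ = wedge-≤ ; col = wedge-col }

bar-≤ : Fin 2 → Fin 2 → Set
bar-≤ f0 _  = ⊤
bar-≤ f1 f1 = ⊤
bar-≤ _  _  = ⊥

Bar¹₁ : CPoset
Bar¹₁ = record { Carrier = Fin 2 ; _≤_ = bar-≤ ; col = λ _ → true }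

-- Countable 2-colored posets whose underlying set is α ∈ ω ∪ {ω}

data Size : Set where
  fin   : ℕ → Size
  omega : Size

Car : Size → Set
Car (fin n) = Fin n
Car omega   = ℕ

num : ∀ {s} → Car s → ℕ
num {fin n} k = toℕ k
num {omega} k = k

record NCPoset : Set₁ where
  field
    size : Size
    _≤_  : Car size → Car size → Set
    col  : Car size → Bool

  cp : CPoset
  cp = record { Carrier = Car size ; _≤_ = _≤_ ; col = col }

  Minimal : Car size → Set
  Minimal p = ∀ q → q ≤ p → q ≡ p

  Maximal : Car size → Set
  Maximal p = ∀ q → p ≤ q → q ≡ p

  record IsShrub : Set₁ where
    field
      isPartialOrder : IsPartialOrder _≡_ _≤_
      noω-chain : ¬ (Σ (ℕ → Car size) λ g →
                      (∀ {m n} → m Data.Nat.≤ n → g m ≤ g n) × Injective _≡_ _≡_ g)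
      finiteDown : ∀ p → Σ (List (Car size)) λ L → ∀ q → q ≤ p → q ∈ L
      bot : Car size
      bot-minimal : Minimal bot
      boundedComplete : ∀ (S : Car size → Set) →
        (∃ λ u → ∀ s → S s → s ≤ u) →
        ∃ λ v → (∀ s → S s → s ≤ v) × (∀ u → (∀ s → S s → s ≤ u) → v ≤ u)

  record InLay : Set₁ where
    field
      shrub : IsShrub
      col-bot : col (IsShrub.bot shrub) ≡ false
      max-col : ∀ p → Maximal p → col p ≡ true
      no-vee   : ¬ (Vee⁰₁ ↣c cp)
      no-wedge : ¬ (Wedge¹₀ ↣c cp)
      no-bar   : ¬ (Bar¹₁ ↣c cp)

  label : IsShrub → Car size → Pω
  label sh p m = ¬ (p ≡ IsShrub.bot sh) × (∃ λ k → num k ≡ m × k ≤ p)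

  𝒜 : InLay → PSet
  𝒜 h x = Level.Lift (lsuc 0ℓ)
            (∃ λ p → col p ≡ true × (∀ m → x m ⇔ label (InLay.shrub h) p m))

-- A colour-1 element p is recovered from its label l p, so 𝒜 P is the union over such p of
-- the differences O_(l p) ∖ {x | x ⊈ l p}: it is Σ⁰₂. Its complement consists of the sets
-- with a finite part that has no colour-1 upper bound, and of the finite sets that are not
-- colour-1 labels; here "finite" holds because in a shrub, by bounded completeness and the
-- absence of ω-chains, a set whose finite parts are all bounded is bounded. So 𝒜 P is also Π⁰₂.
--
-- The forbidden patterns say that two colour-1 elements are never neighbours and that a
-- colour-1 element has at most one upper and at most one lower cover. Given a homomorphism
-- φ, x ↦ ⋃ {l (φ p) | l p ⊆ x} is continuous and maps colour-1 labels l p to l (φ p); enlarging it, for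
-- colour-1 p with x ⊋ l p, by the intersection of the labels strictly above φ p makes it map
-- non-labels to non-labels. Conversely, from a reduction f, send p to the largest q with
-- l q ⊆ f (l p), moved up to its unique upper cover when the colours disagree.

module Submission where

open import Defs
open import Level using (0ℓ)
open import Data.Product using (_×_)
open import Function.Bundles using (_⇔_)
open import Axiom.ExcludedMiddle using (ExcludedMiddle)

open import Level using (Lift; lift; lower)
open import Axiom.DoubleNegationElimination using (em⇒dne)
open import Data.Bool using (true; false)
open import Data.Empty using (⊥; ⊥-elim)
open import Data.Unit using (⊤; tt)
open import Data.Fin using (Fin) renaming (zero to fz; suc to fs)
import Data.Fin.Properties as Fin
open import Data.List using (List; []; _∷_; [_]; _++_; map; filter; length; upTo)
open import Data.List.Extrema.Nat using (max; xs≤max)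
open import Data.List.Membership.Propositional using (_∈_; _∉_)
open import Data.List.Membership.Propositional.Properties
  using (∈-filter⁺; ∈-filter⁻; ∈-map⁺; ∈-map⁻; ∈-upTo⁺; ∈-++⁺ˡ; ∈-++⁺ʳ; ∈-++⁻)
open import Data.List.Properties using (filter-notAll)
open import Data.List.Relation.Unary.All using (lookup)
open import Data.List.Relation.Unary.Any using (here; there)
import Data.List.Relation.Unary.Any as Any
open import Data.List.Relation.Unary.Any.Properties using (¬Any[])
open import Data.Nat as ℕ using (ℕ; zero; suc)
import Data.Nat.Properties as ℕ
open import Data.Nat.Binary using (ℕᵇ; zero; 2[1+_]; 1+[2_]) renaming (toℕ to ℕᵇ-toℕ)
import Data.Nat.Binary.Properties as ℕᵇ
open import Data.Product using (∃; _,_; proj₁; proj₂)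
open import Data.Sum using (_⊎_; inj₁; inj₂; [_,_]′)
open import Function.Base using (id; _∘_; _$_)
open import Function.Bundles using (mk⇔; Equivalence)
open import Function.Definitions using (Injective)
open import Relation.Binary.Definitions using (tri<; tri≈; tri>)
open import Relation.Binary.PropositionalEquality using (_≡_; _≢_; refl; sym; trans; cong; subst; module ≡-Reasoning)
open import Relation.Binary.Structures using (IsPartialOrder)
open import Relation.Nullary using (¬_; Dec; yes; no; ¬?)
open import Relation.Nullary.Decidable using (map′)

open Equivalence using (to; from)

_⊆_ : Pω → Pω → Set
x ⊆ y = ∀ {m} → x m → y m

_⊈_ : Pω → Pω → Set
x ⊈ y = ∃ λ m → x m × ¬ y m

_≐_ : Pω → Pω → Set
x ≐ y = ∀ m → x m ⇔ y m

⟦_⟧ : List ℕ → Pω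
⟦ G ⟧ m = m ∈ G

false≢true : false ≢ true
false≢true ()

num-injective : ∀ {s} {a b : Car s} → num a ≡ num b → a ≡ b
num-injective {fin n} = Fin.toℕ-injective
num-injective {omega} e = e

_≟ᶜ_ : ∀ {s} (a b : Car s) → Dec (a ≡ b)
a ≟ᶜ b = map′ num-injective (cong num) (num a ℕ.≟ num b)

∃-fresh : (G : List ℕ) → ∃ λ m → m ∉ G
∃-fresh G = suc (max 0 G) , λ m∈G → ℕ.<-irrefl refl (lookup (xs≤max 0 G) m∈G)

ImmPred-irrefl : ∀ (R : CPoset) {x} → ¬ ImmPred R x x
ImmPred-irrefl _ ((_ , x≢x) , _) = x≢x refl

module Classical (em : ExcludedMiddle 0ℓ) where

  dne : {A : Set} → ¬ ¬ A → A
  dne = em⇒dne em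

  ¬⊆⇒⊈ : {x y : Pω} → ¬ x ⊆ y → x ⊈ y
  ¬⊆⇒⊈ x⊄y = dne λ x⊆y → x⊄y λ {m} xm → dne λ ¬ym → x⊆y (m , xm , ¬ym)

  select : {A : Set} → (A → Set) → List A → List A
  select R = filter (λ a → em {R a})

  ∈-select⁺ : {A : Set} (R : A → Set) {L : List A} {a : A} → a ∈ L → R a → a ∈ select R L
  ∈-select⁺ R = ∈-filter⁺ (λ a → em {R a})

  ∈-select⁻ : {A : Set} (R : A → Set) (L : List A) {a : A} → a ∈ select R L → a ∈ L × R a
  ∈-select⁻ R L = ∈-filter⁻ (λ a → em {R a})

module ShrubProperties (em : ExcludedMiddle 0ℓ) (P : NCPoset) (sh : NCPoset.IsShrub P) where
  open Classical em
  open NCPoset P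
  open IsShrub sh
  open IsPartialOrder isPartialOrder public using (antisym)
    renaming (refl to ≤-refl; trans to ≤-trans; reflexive to ≤-reflexive)

  C : Set
  C = Car size

  _≺_ _⋖_ : C → C → Set
  _≺_ = _<_ cp
  _⋖_ = ImmPred cp

  l : C → Pω
  l = label sh

  ⋂-above : C → Pω
  ⋂-above q m = ∀ r → q ≺ r → l r m

  bot-least : ∀ p → bot ≤ p
  bot-least p with v , _ , least ← boundedComplete (λ _ → ⊥) (bot , λ _ ()) =
    subst (_≤ p) (bot-minimal v (least bot λ _ ())) (least p λ _ ())

  l-mono : ∀ {p p'} → p ≤ p' → l p ⊆ l p'
  l-mono {p} p≤p' (p≢bot , k , e , k≤p) =
    (λ p'≡bot → p≢bot (bot-minimal p (subst (p ≤_) p'≡bot p≤p'))) , k , e , ≤-trans k≤p p≤p'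

  num∈l : ∀ {p} → p ≢ bot → l p (num p)
  num∈l p≢bot = p≢bot , _ , refl , ≤-refl

  num∈l⇒≤ : ∀ {q r} → l q (num r) → r ≤ q
  num∈l⇒≤ {q} (_ , k , e , k≤q) = subst (_≤ q) (num-injective e) k≤q

  l-bot-empty : ∀ {m} → ¬ l bot m
  l-bot-empty (bot≢bot , _) = bot≢bot refl

  l⊆⇒≤ : ∀ {p q} → l p ⊆ l q → p ≤ q
  l⊆⇒≤ {p} {q} lp⊆lq with p ≟ᶜ bot
  ... | yes refl = bot-least q
  ... | no p≢bot = num∈l⇒≤ (lp⊆lq (num∈l p≢bot))

  l-finite : ∀ p → ∃ λ G → ⟦ G ⟧ ≐ l p
  l-finite p with p ≟ᶜ bot | finiteDown p
  ... | yes refl | _ = [] , λ m → mk⇔ (λ ()) (⊥-elim ∘ l-bot-empty)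
  ... | no p≢bot | L , L-covers = map num (select (_≤ p) L) , λ _ → mk⇔ into out
    where
    into : ∀ {m} → m ∈ map num (select (_≤ p) L) → l p m
    into m∈ with k , k∈ , refl ← ∈-map⁻ num m∈ = p≢bot , k , refl , proj₂ (∈-select⁻ _ L k∈)
    out : ∀ {m} → l p m → m ∈ map num (select (_≤ p) L)
    out (_ , k , refl , k≤p) = ∈-map⁺ num (∈-select⁺ (_≤ p) (L-covers k k≤p) k≤p)

  no-ascending-chain : (g : ℕ → C) → (∀ n → g n ≺ g (suc n)) → ⊥
  no-ascending-chain g g↑ = noω-chain (g , mono , injective)
    where
    mono′ : ∀ {m n} → m ℕ.≤′ n → g m ≤ g n
    mono′ ℕ.≤′-refl = ≤-refl
    mono′ (ℕ.≤′-step m≤n) = ≤-trans (mono′ m≤n) (proj₁ (g↑ _))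
    mono : ∀ {m n} → m ℕ.≤ n → g m ≤ g n
    mono = mono′ ∘ ℕ.≤⇒≤′
    separated : ∀ {m n} → m ℕ.< n → g m ≢ g n
    separated {m} m<n gm≡gn =
      proj₂ (g↑ m) (antisym (proj₁ (g↑ m)) (subst (g (suc m) ≤_) (sym gm≡gn) (mono m<n)))
    injective : Injective _≡_ _≡_ g
    injective {m} {n} gm≡gn with ℕ.<-cmp m n
    ... | tri< m<n _ _ = ⊥-elim (separated m<n gm≡gn)
    ... | tri≈ _ m≡n _ = m≡n
    ... | tri> _ _ n<m = ⊥-elim (separated n<m (sym gm≡gn))

  maximal-above : (S : C → Set) {s : C} → S s →
                  ∃ λ m → S m × s ≤ m × (∀ u → S u → m ≤ u → u ≡ m)
  maximal-above S {s} Ss = dne λ ∄m → no-ascending-chain (proj₁ ∘ chain ∄m) (proj₂ ∘ larger ∄m ∘ chain ∄m)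
    where
    Above : Set
    Above = ∃ λ r → S r × s ≤ r
    NoMaximal : Set
    NoMaximal = ¬ (∃ λ m → S m × s ≤ m × (∀ u → S u → m ≤ u → u ≡ m))
    larger : NoMaximal → (r : Above) → ∃ λ (u : Above) → proj₁ r ≺ proj₁ u
    larger ∄m (r , Sr , s≤r) = dne λ ∄u → ∄m (r , Sr , s≤r , λ u Su r≤u → dne λ u≢r →
      ∄u ((u , Su , ≤-trans s≤r r≤u) , r≤u , u≢r ∘ sym))
    chain : NoMaximal → ℕ → Above
    chain ∄m zero = s , Ss , ≤-refl
    chain ∄m (suc n) = proj₁ (larger ∄m (chain ∄m n))

  minimal-below : (S : C → Set) {p : C} → S p →
                  ∃ λ m → S m × m ≤ p × (∀ u → S u → u ≤ m → u ≡ m)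
  minimal-below S {p} Sp with L , L-covers ← finiteDown p = descend (length L) L ℕ.≤-refl L-covers Sp
    where
    descend : ∀ n {p} (L : List C) → length L ℕ.≤ n → (∀ q → q ≤ p → q ∈ L) → S p →
              ∃ λ m → S m × m ≤ p × (∀ u → S u → u ≤ m → u ≡ m)
    descend zero [] _ covers _ = ⊥-elim (¬Any[] (covers _ ≤-refl))
    descend (suc n) {p} L |L|≤1+n covers Sp with em {∃ λ u → S u × u ≺ p}
    ... | no ∄u = p , Sp , ≤-refl , λ u Su u≤p → dne λ u≢p → ∄u (u , Su , u≤p , u≢p)
    ... | yes (u , Su , u≤p , u≢p) =
      let m , Sm , m≤u , minimal = descend n L' |L'|≤n covers' Su in m , Sm , ≤-trans m≤u u≤p , minimal
      where
      ≢p? : ∀ q → Dec (q ≢ p)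
      ≢p? q = ¬? (q ≟ᶜ p)
      L' : List C
      L' = filter ≢p? L
      |L'|≤n : length L' ℕ.≤ n
      |L'|≤n = ℕ.≤-pred (ℕ.≤-trans (filter-notAll ≢p? L p∈L) |L|≤1+n)
        where p∈L = Any.map (λ q≡p q≢p → q≢p (sym q≡p)) (covers p ≤-refl)
      covers' : ∀ q → q ≤ u → q ∈ L'
      covers' q q≤u = ∈-filter⁺ ≢p? (covers q (≤-trans q≤u u≤p))
        λ q≡p → u≢p (antisym u≤p (subst (_≤ u) q≡p q≤u))

  successor-below : ∀ {q r} → q ≺ r → ∃ λ s → q ⋖ s × s ≤ r
  successor-below {q} q≺r with s , q≺s , s≤r , minimal ← minimal-below (q ≺_) q≺r =
    s , (q≺s , λ { (v , q≺v , v≺s) → proj₂ v≺s (minimal v q≺v (proj₁ v≺s)) }) , s≤r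

  predecessor-above : ∀ {r t} → r ≺ t → ∃ λ m → r ≤ m × m ⋖ t
  predecessor-above {r} {t} r≺t
    with m , (r≤m , m≺t) , _ , maximal ← maximal-above (λ u → r ≤ u × u ≺ t) (≤-refl , r≺t) =
    m , r≤m , (m≺t , λ { (v , m≺v , v≺t) → proj₂ m≺v (sym (maximal v (≤-trans r≤m (proj₁ m≺v) , v≺t) (proj₁ m≺v))) })

  FinitelyBounded : Pω → Set
  FinitelyBounded x = ∀ F → F ⊆fin x → ∃ λ p → F ⊆fin l p

  -- The suprema s n of the elements numbered below n in x form a monotone
  -- sequence; a maximal term, which exists as there are no ω-chains, bounds all of x.
  finitelyBounded⇒bounded : ∀ x → FinitelyBounded x → ∃ λ u → ∀ {m} → x m → ∃ λ k → num k ≡ m × k ≤ u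
  finitelyBounded⇒bounded x bounded = let n₀ , s≤sn₀ = s-bounded in s n₀ , λ {m} xm →
    let _ , k , k≡m , _ = proj₂ (bounded [ m ] (λ { (here refl) → xm })) (here refl)
        k∈Below : Below (suc m) k
        k∈Below = subst x (sym k≡m) xm , subst (ℕ._< suc m) (sym k≡m) (ℕ.n<1+n m)
    in k , k≡m , ≤-trans (s-upper k∈Below) (s≤sn₀ (suc m))
    where
    Below : ℕ → C → Set
    Below n r = x (num r) × num r ℕ.< n
    sup : ∀ n → ∃ λ v → (∀ r → Below n r → r ≤ v) × (∀ u → (∀ r → Below n r → r ≤ u) → v ≤ u)
    sup n with p , bound ← bounded (select x (upTo n)) (proj₂ ∘ ∈-select⁻ x (upTo n)) =
      boundedComplete (Below n) (p , λ { r (xr , r<n) → num∈l⇒≤ (bound (∈-select⁺ x (∈-upTo⁺ r<n) xr)) })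
    s : ℕ → C
    s n = proj₁ (sup n)
    s-upper : ∀ {n r} → Below n r → r ≤ s n
    s-upper = proj₁ (proj₂ (sup _)) _
    s-mono : ∀ {n n'} → n ℕ.≤ n' → s n ≤ s n'
    s-mono {n} {n'} n≤n' = proj₂ (proj₂ (sup n)) (s n') λ { r (xr , r<n) → s-upper (xr , ℕ.<-≤-trans r<n n≤n') }
    s-bounded : ∃ λ n₀ → ∀ n → s n ≤ s n₀
    s-bounded with _ , (n₀ , refl) , _ , maximal ← maximal-above (λ v → ∃ λ n → v ≡ s n) (0 , refl) =
      n₀ , λ n → [ s-mono , (λ n₀≤n → ≤-reflexive (maximal (s n) (n , refl) (s-mono n₀≤n))) ]′ (ℕ.≤-total n n₀)

  finitelyBounded⇒finite : ∀ x → FinitelyBounded x → ∃ λ G → x ≐ ⟦ G ⟧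
  finitelyBounded⇒finite x bounded with u , x≤u ← finitelyBounded⇒bounded x bounded =
    select x (map num D) , λ m → mk⇔ into (proj₂ ∘ ∈-select⁻ x (map num D))
    where
    D : List C
    D = proj₁ (finiteDown u)
    into : ∀ {m} → x m → m ∈ select x (map num D)
    into xm with k , refl , k≤u ← x≤u xm = ∈-select⁺ x (∈-map⁺ num (proj₂ (finiteDown u) k k≤u)) xm

module LayProperties (em : ExcludedMiddle 0ℓ) (P : NCPoset) (hP : NCPoset.InLay P) where
  open NCPoset P public using (_≤_; col)
  open NCPoset P using (cp; IsShrub; InLay)
  open InLay hP
  open ShrubProperties em P shrub public
  open IsShrub shrub public using (bot; bot-minimal; boundedComplete)

  pattern a = fz
  pattern b = fs fz
  pattern c = fs (fs fz)

  bar↣ : ∀ {p q} → col p ≡ true → col q ≡ true → p ⋖ q → Bar¹₁ ↣c cp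
  bar↣ {p} {q} p∈1 q∈1 p⋖q@((p≤q , p≢q) , _) = φ , (hom , colours) , injective , covers
    where
    φ : Fin 2 → C
    φ a = p
    φ b = q
    hom : ∀ {x y} → bar-≤ x y → φ x ≤ φ y
    hom {a} {a} _ = ≤-refl
    hom {a} {b} _ = p≤q
    hom {b} {b} _ = ≤-refl
    colours : ∀ x → col (φ x) ≡ true
    colours a = p∈1
    colours b = q∈1
    injective : Injective _≡_ _≡_ φ
    injective {a} {a} _ = refl
    injective {a} {b} p≡q = ⊥-elim (p≢q p≡q)
    injective {b} {a} q≡p = ⊥-elim (p≢q (sym q≡p))
    injective {b} {b} _ = refl
    covers : ∀ {x y} → ImmPred Bar¹₁ x y → φ x ⋖ φ y
    covers {a} {b} _ = p⋖q
    covers {b} {a} ((() , _) , _)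
    covers {a} {a} x⋖x = ⊥-elim (ImmPred-irrefl Bar¹₁ x⋖x)
    covers {b} {b} x⋖x = ⊥-elim (ImmPred-irrefl Bar¹₁ x⋖x)

  vee↣ : ∀ {p q r} → col p ≡ true → col q ≡ false → col r ≡ false →
         p ⋖ q → p ⋖ r → q ≢ r → Vee⁰₁ ↣c cp
  vee↣ {p} {q} {r} p∈1 q∈0 r∈0 p⋖q@((p≤q , p≢q) , _) p⋖r@((p≤r , p≢r) , _) q≢r =
    φ , (hom , colours) , injective , covers
    where
    φ : Fin 3 → C
    φ a = p
    φ b = q
    φ c = r
    hom : ∀ {x y} → vee-≤ x y → φ x ≤ φ y
    hom {a} {a} _ = ≤-refl
    hom {a} {b} _ = p≤q
    hom {a} {c} _ = p≤r
    hom {b} {b} _ = ≤-refl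
    hom {c} {c} _ = ≤-refl
    hom {b} {a} ()
    hom {b} {c} ()
    hom {c} {a} ()
    hom {c} {b} ()
    colours : ∀ x → col (φ x) ≡ vee-col x
    colours a = p∈1
    colours b = q∈0
    colours c = r∈0
    injective : Injective _≡_ _≡_ φ
    injective {a} {a} _ = refl
    injective {b} {b} _ = refl
    injective {c} {c} _ = refl
    injective {a} {b} p≡q = ⊥-elim (p≢q p≡q)
    injective {b} {a} q≡p = ⊥-elim (p≢q (sym q≡p))
    injective {a} {c} p≡r = ⊥-elim (p≢r p≡r)
    injective {c} {a} r≡p = ⊥-elim (p≢r (sym r≡p))
    injective {b} {c} q≡r = ⊥-elim (q≢r q≡r)
    injective {c} {b} r≡q = ⊥-elim (q≢r (sym r≡q))
    covers : ∀ {x y} → ImmPred Vee⁰₁ x y → φ x ⋖ φ y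
    covers {a} {b} _ = p⋖q
    covers {a} {c} _ = p⋖r
    covers {a} {a} x⋖x = ⊥-elim (ImmPred-irrefl Vee⁰₁ x⋖x)
    covers {b} {b} x⋖x = ⊥-elim (ImmPred-irrefl Vee⁰₁ x⋖x)
    covers {c} {c} x⋖x = ⊥-elim (ImmPred-irrefl Vee⁰₁ x⋖x)
    covers {b} {a} ((() , _) , _)
    covers {b} {c} ((() , _) , _)
    covers {c} {a} ((() , _) , _)
    covers {c} {b} ((() , _) , _)

  wedge↣ : ∀ {p q r} → col p ≡ false → col q ≡ false → col r ≡ true →
           p ⋖ r → q ⋖ r → p ≢ q → Wedge¹₀ ↣c cp
  wedge↣ {p} {q} {r} p∈0 q∈0 r∈1 p⋖r@((p≤r , p≢r) , _) q⋖r@((q≤r , q≢r) , _) p≢q =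
    φ , (hom , colours) , injective , covers
    where
    φ : Fin 3 → C
    φ a = p
    φ b = q
    φ c = r
    hom : ∀ {x y} → wedge-≤ x y → φ x ≤ φ y
    hom {a} {a} _ = ≤-refl
    hom {b} {b} _ = ≤-refl
    hom {c} {c} _ = ≤-refl
    hom {a} {c} _ = p≤r
    hom {b} {c} _ = q≤r
    hom {a} {b} ()
    hom {b} {a} ()
    hom {c} {a} ()
    hom {c} {b} ()
    colours : ∀ x → col (φ x) ≡ wedge-col x
    colours a = p∈0
    colours b = q∈0
    colours c = r∈1
    injective : Injective _≡_ _≡_ φ
    injective {a} {a} _ = refl
    injective {b} {b} _ = refl
    injective {c} {c} _ = refl
    injective {a} {b} p≡q = ⊥-elim (p≢q p≡q)
    injective {b} {a} q≡p = ⊥-elim (p≢q (sym q≡p))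
    injective {a} {c} p≡r = ⊥-elim (p≢r p≡r)
    injective {c} {a} r≡p = ⊥-elim (p≢r (sym r≡p))
    injective {b} {c} q≡r = ⊥-elim (q≢r q≡r)
    injective {c} {b} r≡q = ⊥-elim (q≢r (sym r≡q))
    covers : ∀ {x y} → ImmPred Wedge¹₀ x y → φ x ⋖ φ y
    covers {a} {c} _ = p⋖r
    covers {b} {c} _ = q⋖r
    covers {a} {a} x⋖x = ⊥-elim (ImmPred-irrefl Wedge¹₀ x⋖x)
    covers {b} {b} x⋖x = ⊥-elim (ImmPred-irrefl Wedge¹₀ x⋖x)
    covers {c} {c} x⋖x = ⊥-elim (ImmPred-irrefl Wedge¹₀ x⋖x)
    covers {a} {b} ((() , _) , _)
    covers {b} {a} ((() , _) , _)
    covers {c} {a} ((() , _) , _)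
    covers {c} {b} ((() , _) , _)

  no-1⋖1 : ∀ {p q} → col p ≡ true → col q ≡ true → ¬ p ⋖ q
  no-1⋖1 p∈1 q∈1 = no-bar ∘ bar↣ p∈1 q∈1

  upper-cover-of-1-is-0 : ∀ {p q} → col p ≡ true → p ⋖ q → col q ≡ false
  upper-cover-of-1-is-0 {q = q} p∈1 p⋖q with col q in q∈
  ... | false = refl
  ... | true = ⊥-elim (no-1⋖1 p∈1 q∈ p⋖q)

  lower-cover-of-1-is-0 : ∀ {p q} → col q ≡ true → p ⋖ q → col p ≡ false
  lower-cover-of-1-is-0 {p = p} q∈1 p⋖q with col p in p∈
  ... | false = refl
  ... | true = ⊥-elim (no-1⋖1 p∈ q∈1 p⋖q)

  upper-cover-of-1-unique : ∀ {p q r} → col p ≡ true → p ⋖ q → p ⋖ r → q ≡ r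
  upper-cover-of-1-unique {q = q} {r} p∈1 p⋖q p⋖r with q ≟ᶜ r
  ... | yes q≡r = q≡r
  ... | no q≢r = ⊥-elim (no-vee (vee↣ p∈1 (upper-cover-of-1-is-0 p∈1 p⋖q) (upper-cover-of-1-is-0 p∈1 p⋖r)
                                       p⋖q p⋖r q≢r))

  lower-cover-of-1-unique : ∀ {p q r} → col r ≡ true → p ⋖ r → q ⋖ r → p ≡ q
  lower-cover-of-1-unique {p} {q} r∈1 p⋖r q⋖r with p ≟ᶜ q
  ... | yes p≡q = p≡q
  ... | no p≢q = ⊥-elim (no-wedge (wedge↣ (lower-cover-of-1-is-0 r∈1 p⋖r) (lower-cover-of-1-is-0 r∈1 q⋖r) r∈1
                                           p⋖r q⋖r p≢q))

  upper-cover-of-1-least : ∀ {q s r} → col q ≡ true → q ⋖ s → q ≺ r → s ≤ r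
  upper-cover-of-1-least q∈1 q⋖s q≺r with s' , q⋖s' , s'≤r ← successor-below q≺r =
    subst (_≤ _) (sym (upper-cover-of-1-unique q∈1 q⋖s q⋖s')) s'≤r

  lower-cover-of-1-greatest : ∀ {m t r} → col t ≡ true → m ⋖ t → r ≺ t → r ≤ m
  lower-cover-of-1-greatest t∈1 m⋖t r≺t with m' , r≤m' , m'⋖t ← predecessor-above r≺t =
    subst (_ ≤_) (lower-cover-of-1-unique t∈1 m'⋖t m⋖t) r≤m'

  below-maximal : ∀ p → ∃ λ M → col M ≡ true × p ≤ M
  below-maximal p with M , _ , p≤M , maximal ← maximal-above (λ _ → ⊤) tt =
    M , max-col M (λ q M≤q → maximal q tt M≤q) , p≤M

  col-1⇒≢bot : ∀ {p} → col p ≡ true → p ≢ bot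
  col-1⇒≢bot p∈1 refl with () ← trans (sym p∈1) col-bot

  -- The witness is the upper cover of q, or any fresh number if q is maximal.
  ⋂-above⊈l : ∀ {q} → col q ≡ true → ⋂-above q ⊈ l q
  ⋂-above⊈l {q} q∈1 with em {∃ λ r → q ≺ r}
  ... | no ∄r = let m , m∉ = ∃-fresh (proj₁ (l-finite q)) in
    m , (λ r q≺r → ⊥-elim (∄r (r , q≺r))) , m∉ ∘ from (proj₂ (l-finite q) m)
  ... | yes (_ , q≺r) with s , q⋖s@((q≤s , q≢s) , _) , _ ← successor-below q≺r =
    num s , (λ r q≺r → l-mono (upper-cover-of-1-least q∈1 q⋖s q≺r) (num∈l s≢bot)) ,
    λ s∈lq → q≢s (antisym q≤s (num∈l⇒≤ s∈lq))
    where
    s≢bot : s ≢ bot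
    s≢bot s≡bot = col-1⇒≢bot q∈1 (bot-minimal q (subst (q ≤_) s≡bot q≤s))

cons : ℕ → ℕᵇ → ℕᵇ
cons zero b = 2[1+ b ]
cons (suc a) b = 1+[2 cons a b ]

cons-injective : ∀ {a a' b b'} → cons a b ≡ cons a' b' → a ≡ a' × b ≡ b'
cons-injective {zero} {zero} e = refl , ℕᵇ.2[1+_]-injective e
cons-injective {suc a} {suc a'} e with refl , b≡b' ← cons-injective {a} {a'} (ℕᵇ.1+[2_]-injective e) = refl , b≡b'

cons≢zero : ∀ {a b} → cons a b ≢ zero
cons≢zero {zero} ()
cons≢zero {suc a} ()

encode : List ℕ → ℕᵇ
encode [] = zero
encode (a ∷ G) = cons a (encode G)

encode-injective : Injective _≡_ _≡_ encode
encode-injective {[]} {[]} _ = refl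
encode-injective {[]} {_ ∷ _} e = ⊥-elim (cons≢zero (sym e))
encode-injective {_ ∷ _} {[]} e = ⊥-elim (cons≢zero e)
encode-injective {a ∷ G} {a' ∷ G'} e with refl , e' ← cons-injective {a} {a'} e = cong (a ∷_) (encode-injective e')

code : List ℕ → ℕ
code = ℕᵇ-toℕ ∘ encode

code-injective : Injective _≡_ _≡_ code
code-injective = encode-injective ∘ ℕᵇ.toℕ-injective

Opens : (List ℕ → Set) → PSet
Opens 𝓕 x = Lift _ (∃ λ F → 𝓕 F × F ⊆fin x)

Opens-isOpen : ∀ 𝓕 → IsOpen (Opens 𝓕)
Opens-isOpen 𝓕 = 𝓕 , λ _ → mk⇔ lower lift

Meets : (ℕ → Set) → PSet
Meets K = Opens λ F → ∃ λ k → K k × F ≡ [ k ]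

meets : ∀ {K : ℕ → Set} {x : Pω} {k} → K k → x k → Meets K x
meets {k = k} Kk xk = lift ([ k ] , (k , Kk , refl) , λ { (here refl) → xk })

meets⁻ : ∀ {K : ℕ → Set} {x : Pω} → Meets K x → ∃ λ k → K k × x k
meets⁻ (lift (_ , (k , Kk , refl) , k∈x)) = k , Kk , k∈x (here refl)

module Complexity (em : ExcludedMiddle 0ℓ) (P : NCPoset) (hP : NCPoset.InLay P) where
  open Classical em
  open NCPoset P using (𝒜)
  open LayProperties em P hP

  𝒜-Σ⁰₂ : Σ⁰₂ (𝒜 hP)
  𝒜-Σ⁰₂ = B , B' , Opens-isOpen ∘ Labels , Opens-isOpen ∘ _ , λ x → mk⇔ into out
    where
    Labels : ℕ → List ℕ → Set
    Labels i F = ∃ λ p → num p ≡ i × col p ≡ true × ⟦ F ⟧ ≐ l p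
    B B' : ℕ → PSet
    B i = Opens (Labels i)
    B' i = Meets λ k → ∃ λ p → num p ≡ i × ¬ l p k
    into : ∀ {x} → 𝒜 hP x → ∃ λ i → B i x × ¬ B' i x
    into (lift (p , p∈1 , x≐lp)) with F , F≐lp ← l-finite p =
      num p , lift (F , (p , refl , p∈1 , F≐lp) , from (x≐lp _) ∘ to (F≐lp _)) , λ B'x →
        let k , (p' , p'≡p , k∉lp') , xk = meets⁻ B'x
        in k∉lp' (subst (λ p → l p k) (num-injective (sym p'≡p)) (to (x≐lp k) xk))
    out : ∀ {x} → (∃ λ i → B i x × ¬ B' i x) → 𝒜 hP x
    out (_ , lift (F , (p , p≡i , p∈1 , F≐lp) , F⊆x) , ¬B'x) = lift (p , p∈1 , λ m → mk⇔
      (λ xm → dne λ m∉lp → ¬B'x (meets (p , p≡i , m∉lp) xm))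
      (F⊆x ∘ from (F≐lp m)))

  𝒜-Π⁰₂ : Π⁰₂ (𝒜 hP)
  𝒜-Π⁰₂ = B , B' , isOpen-B , isOpen-B' , λ x → mk⇔ into out
    where
    Bounded IsLabel : List ℕ → Set
    Bounded F = ∃ λ p → col p ≡ true × F ⊆fin l p
    IsLabel G = ∃ λ p → col p ≡ true × ⟦ G ⟧ ≐ l p
    B B' : ℕ → PSet
    B zero = Opens (¬_ ∘ Bounded)
    B (suc j) = Opens λ G → code G ≡ j × ¬ IsLabel G
    B' zero = Opens λ _ → ⊥
    B' (suc j) = Meets λ k → ∃ λ G → code G ≡ j × k ∉ G
    isOpen-B : ∀ i → IsOpen (B i)
    isOpen-B zero = Opens-isOpen _
    isOpen-B (suc j) = Opens-isOpen _
    isOpen-B' : ∀ i → IsOpen (B' i)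
    isOpen-B' zero = Opens-isOpen _
    isOpen-B' (suc j) = Opens-isOpen _
    into : ∀ {x} → ¬ 𝒜 hP x → ∃ λ i → B i x × ¬ B' i x
    into {x} x∉𝒜 with em {∃ λ F → ¬ Bounded F × F ⊆fin x}
    ... | yes (F , ¬bounded , F⊆x) = zero , lift (F , ¬bounded , F⊆x) , λ { (lift (_ , () , _)) }
    ... | no ∄F = finite-case (finitelyBounded⇒finite x finitelyBounded)
      where
      finitelyBounded : FinitelyBounded x
      finitelyBounded F F⊆x = let p , _ , F⊆lp = dne λ ¬bounded → ∄F (F , ¬bounded , F⊆x) in p , F⊆lp
      finite-case : (∃ λ G → x ≐ ⟦ G ⟧) → ∃ λ i → B i x × ¬ B' i x
      finite-case (G , x≐G) = suc (code G) , lift (G , (refl , ¬label) , from (x≐G _)) , λ B'x →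
        let k , (G' , G'≡G , k∉G') , xk = meets⁻ B'x
        in k∉G' (subst (k ∈_) (sym (code-injective G'≡G)) (to (x≐G k) xk))
        where
        ¬label : ¬ IsLabel G
        ¬label (p , p∈1 , G≐lp) = x∉𝒜 (lift (p , p∈1 , λ m → mk⇔ (to (G≐lp m) ∘ to (x≐G m)) (from (x≐G m) ∘ from (G≐lp m))))
    out : ∀ {x} → (∃ λ i → B i x × ¬ B' i x) → ¬ 𝒜 hP x
    out (zero , lift (F , ¬bounded , F⊆x) , _) (lift (p , p∈1 , x≐lp)) = ¬bounded (p , p∈1 , to (x≐lp _) ∘ F⊆x)
    out (suc j , lift (G , (G≡j , ¬label) , G⊆x) , ¬B'x) (lift (p , p∈1 , x≐lp)) = ¬label (p , p∈1 , λ m → mk⇔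
      (to (x≐lp m) ∘ G⊆x)
      (λ m∈lp → dne λ m∉G → ¬B'x (meets (G , G≡j , m∉G) (from (x≐lp m) m∈lp))))

  𝒜-Δ⁰₂ : Δ⁰₂ (𝒜 hP)
  𝒜-Δ⁰₂ = 𝒜-Σ⁰₂ , 𝒜-Π⁰₂

Monotone : (Pω → Pω) → Set₁
Monotone f = ∀ {x y} → x ⊆ y → f x ⊆ f y

Finitary : (Pω → Pω) → Set₁
Finitary f = ∀ {x m} → f x m → ∃ λ G → G ⊆fin x × f ⟦ G ⟧ m

monotone∧finitary⇒continuous : ∀ {f} → Monotone f → Finitary f → Continuous f
monotone∧finitary⇒continuous {f} mono finitary U (𝓕 , U≐) = 𝓕' , λ x → mk⇔ into out
  where
  𝓕' : List ℕ → Set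
  𝓕' G = ∃ λ F → 𝓕 F × F ⊆fin f ⟦ G ⟧
  gather : ∀ {x} F → F ⊆fin f x → ∃ λ G → G ⊆fin x × F ⊆fin f ⟦ G ⟧
  gather [] _ = [] , (λ ()) , (λ ())
  gather (m ∷ F) m∷F⊆fx with G₁ , G₁⊆x , m∈fG₁ ← finitary (m∷F⊆fx (here refl))
                           | G₂ , G₂⊆x , F⊆fG₂ ← gather F (m∷F⊆fx ∘ there) =
    G₁ ++ G₂ , [ G₁⊆x , G₂⊆x ]′ ∘ ∈-++⁻ G₁ ,
    λ { (here refl) → mono ∈-++⁺ˡ m∈fG₁ ; (there m'∈F) → mono (∈-++⁺ʳ G₁) (F⊆fG₂ m'∈F) }
  into : ∀ {x} → U (f x) → ∃ λ G → 𝓕' G × G ⊆fin x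
  into {x} Ufx with F , 𝓕F , F⊆fx ← to (U≐ (f x)) Ufx with G , G⊆x , F⊆fG ← gather F F⊆fx =
    G , (F , 𝓕F , F⊆fG) , G⊆x
  out : ∀ {x} → (∃ λ G → 𝓕' G × G ⊆fin x) → U (f x)
  out {x} (G , (F , 𝓕F , F⊆fG) , G⊆x) = from (U≐ (f x)) (F , 𝓕F , mono G⊆x ∘ F⊆fG)

continuous⇒monotone : ∀ {f} → Continuous f → Monotone f
continuous⇒monotone {f} continuous {x} {y} x⊆y {k} fxk
  with 𝓕 , V≐ ← continuous (Meets (_≡ k)) (Opens-isOpen _)
  with G , 𝓕G , G⊆x ← to (V≐ x) (meets refl fxk)
  with _ , refl , fyk ← meets⁻ (from (V≐ y) (G , 𝓕G , x⊆y ∘ G⊆x)) = fyk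

module HomomorphismToReduction
  (em : ExcludedMiddle 0ℓ) (em₁ : ExcludedMiddle (Level.suc 0ℓ))
  (P Q : NCPoset) (hP : NCPoset.InLay P) (hQ : NCPoset.InLay Q)
  (φ : Car (NCPoset.size P) → Car (NCPoset.size Q)) (φ-hom : IsHom (NCPoset.cp P) (NCPoset.cp Q) φ)
  where
  open Classical em
  module P′ = LayProperties em P hP
  module Q′ = LayProperties em Q hQ

  φ-mono : ∀ {p p'} → p P′.≤ p' → φ p Q′.≤ φ p'
  φ-mono = proj₁ φ-hom

  φ-col : ∀ p → Q′.col (φ p) ≡ P′.col p
  φ-col = proj₂ φ-hom

  -- p's upper cover s below p' has colour 0, so φ p = φ p' would squeeze φ s onto φ p.
  φ-strict-above-1 : ∀ {p p'} → P′.col p ≡ true → p P′.≺ p' → φ p Q′.≺ φ p'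
  φ-strict-above-1 {p} {p'} p∈1 p≺p'
    with s , p⋖s@((p≤s , _) , _) , s≤p' ← P′.successor-below p≺p' = φ-mono (proj₁ p≺p') , φp≢φp'
    where
    φp≢φp' : φ p ≢ φ p'
    φp≢φp' φp≡φp' = false≢true $ begin
      false         ≡⟨ sym (P′.upper-cover-of-1-is-0 p∈1 p⋖s) ⟩
      P′.col s      ≡⟨ sym (φ-col s) ⟩
      Q′.col (φ s)  ≡⟨ cong Q′.col (Q′.antisym (subst (φ s Q′.≤_) (sym φp≡φp') (φ-mono s≤p')) (φ-mono p≤s)) ⟩
      Q′.col (φ p)  ≡⟨ φ-col p ⟩
      P′.col p      ≡⟨ p∈1 ⟩
      true          ∎
      where open ≡-Reasoning

  -- The second alternative adds, for colour-1 p with x ⊋ l p, everything lying in all labels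
  -- strictly above φ p: this pushes f x out of 𝒜 Q exactly when x is not a label.
  f : Pω → Pω
  f x m = ∃ λ p → P′.l p ⊆ x × (Q′.l (φ p) m ⊎ (P′.col p ≡ true × x ⊈ P′.l p × Q′.⋂-above (φ p) m))

  f-monotone : Monotone f
  f-monotone x⊆y (p , lp⊆x , inj₁ m∈lφp) = p , x⊆y ∘ lp⊆x , inj₁ m∈lφp
  f-monotone x⊆y (p , lp⊆x , inj₂ (p∈1 , (k , xk , k∉lp) , m∈⋂)) =
    p , x⊆y ∘ lp⊆x , inj₂ (p∈1 , (k , x⊆y xk , k∉lp) , m∈⋂)

  f-finitary : Finitary f
  f-finitary (p , lp⊆x , alternative) with G , G≐lp ← P′.l-finite p with alternative
  ... | inj₁ m∈lφp = G , lp⊆x ∘ to (G≐lp _) , p , from (G≐lp _) , inj₁ m∈lφp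
  ... | inj₂ (p∈1 , (k , xk , k∉lp) , m∈⋂) =
    G ++ [ k ] , [ lp⊆x ∘ to (G≐lp _) , (λ { (here refl) → xk }) ]′ ∘ ∈-++⁻ G ,
    p , ∈-++⁺ˡ ∘ from (G≐lp _) , inj₂ (p∈1 , (k , ∈-++⁺ʳ G (here refl) , k∉lp) , m∈⋂)

  f-preserves-𝒜 : ∀ {x} → NCPoset.𝒜 P hP x → NCPoset.𝒜 Q hQ (f x)
  f-preserves-𝒜 {x} (lift (p₀ , p₀∈1 , x≐lp₀)) =
    lift (φ p₀ , trans (φ-col p₀) p₀∈1 , λ m → mk⇔ into λ m∈lφp₀ → p₀ , from (x≐lp₀ _) , inj₁ m∈lφp₀)
    where
    into : ∀ {m} → f x m → Q′.l (φ p₀) m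
    into (p , lp⊆x , inj₁ m∈lφp) = Q′.l-mono (φ-mono (P′.l⊆⇒≤ (to (x≐lp₀ _) ∘ lp⊆x))) m∈lφp
    into (p , lp⊆x , inj₂ (p∈1 , (k , xk , k∉lp) , m∈⋂)) =
      m∈⋂ (φ p₀) (φ-strict-above-1 p∈1 (P′.l⊆⇒≤ (to (x≐lp₀ _) ∘ lp⊆x) , λ { refl → k∉lp (to (x≐lp₀ k) xk) }))

  φ≤-of-f-label : ∀ {x p q} → f x ≐ Q′.l q → P′.l p ⊆ x → φ p Q′.≤ q
  φ≤-of-f-label fx≐lq lp⊆x = Q′.l⊆⇒≤ λ m∈lφp → to (fx≐lq _) (_ , lp⊆x , inj₁ m∈lφp)

  no-collapse : ∀ {x p q} → f x ≐ Q′.l q → Q′.col q ≡ true →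
                P′.l p ⊆ x → φ p ≡ q → P′.col p ≡ true → ¬ x ⊈ P′.l p
  no-collapse fx≐lq q∈1 lp⊆x φp≡q p∈1 x⊈lp =
    let m , m∈⋂ , m∉lq = Q′.⋂-above⊈l q∈1
    in m∉lq (to (fx≐lq m) (_ , lp⊆x , inj₂ (p∈1 , x⊈lp , subst (λ r → Q′.⋂-above r m) (sym φp≡q) m∈⋂)))

  f-reflects-𝒜 : ∀ {x} → ¬ NCPoset.𝒜 P hP x → ¬ NCPoset.𝒜 Q hQ (f x)
  f-reflects-𝒜 {x} x∉𝒜 (lift (q , q∈1 , fx≐lq)) with from (fx≐lq _) (Q′.num∈l (Q′.col-1⇒≢bot q∈1))
  ... | p , lp⊆x , inj₁ q∈lφp = no-collapse fx≐lq q∈1 lp⊆x φp≡q p∈1 x⊈lp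
    where
    φp≡q : φ p ≡ q
    φp≡q = Q′.antisym (φ≤-of-f-label fx≐lq lp⊆x) (Q′.num∈l⇒≤ q∈lφp)
    p∈1 : P′.col p ≡ true
    p∈1 = trans (sym (φ-col p)) (trans (cong Q′.col φp≡q) q∈1)
    x⊈lp : x ⊈ P′.l p
    x⊈lp = ¬⊆⇒⊈ λ x⊆lp → x∉𝒜 (lift (p , p∈1 , λ m → mk⇔ x⊆lp lp⊆x))
  ... | p , lp⊆x , inj₂ (p∈1 , x⊈lp , q∈⋂) with φ p ≟ᶜ q
  ...   | yes φp≡q = no-collapse fx≐lq q∈1 lp⊆x φp≡q p∈1 x⊈lp
  ...   | no φp≢q = Q′.no-1⋖1 (trans (φ-col p) p∈1) q∈1 ((φ≤-of-f-label fx≐lq lp⊆x , φp≢q) ,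
    λ { (v , φp≺v , v≺q) → proj₂ v≺q (Q′.antisym (proj₁ v≺q) (Q′.num∈l⇒≤ (q∈⋂ v φp≺v))) })

  reduction : NCPoset.𝒜 P hP ≤w NCPoset.𝒜 Q hQ
  reduction = f , monotone∧finitary⇒continuous f-monotone f-finitary ,
    λ x → mk⇔ f-preserves-𝒜 λ fx∈𝒜 → em⇒dne em₁ λ x∉𝒜 → f-reflects-𝒜 x∉𝒜 fx∈𝒜

module ReductionToHomomorphism
  (em : ExcludedMiddle 0ℓ) (P Q : NCPoset) (hP : NCPoset.InLay P) (hQ : NCPoset.InLay Q)
  (f : Pω → Pω) (f-continuous : Continuous f)
  (f-reduces : ∀ x → NCPoset.𝒜 P hP x ⇔ NCPoset.𝒜 Q hQ (f x))
  where
  open Classical em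
  module P′ = LayProperties em P hP
  module Q′ = LayProperties em Q hQ

  y : P′.C → Pω
  y p = f (P′.l p)

  y-mono : ∀ {p p'} → p P′.≤ p' → y p ⊆ y p'
  y-mono = continuous⇒monotone f-continuous ∘ P′.l-mono

  y-col-1 : ∀ {p} → P′.col p ≡ true → ∃ λ q → Q′.col q ≡ true × y p ≐ Q′.l q
  y-col-1 {p} p∈1 = lower (to (f-reduces (P′.l p)) (lift (p , p∈1 , λ _ → mk⇔ id id)))

  y-col-0 : ∀ {p} → P′.col p ≡ false → ¬ NCPoset.𝒜 Q hQ (y p)
  y-col-0 {p} p∈0 y∈𝒜 with lift (p' , p'∈1 , lp≐lp') ← from (f-reduces (P′.l p)) y∈𝒜 =
    false≢true (trans (sym p∈0) (trans (cong P′.col p≡p') p'∈1))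
    where
    p≡p' : p ≡ p'
    p≡p' = P′.antisym (P′.l⊆⇒≤ (to (lp≐lp' _))) (P′.l⊆⇒≤ (from (lp≐lp' _)))

  y-bounded : ∀ p → ∃ λ q → y p ⊆ Q′.l q
  y-bounded p with M , M∈1 , p≤M ← P′.below-maximal p with q , _ , yM≐lq ← y-col-1 M∈1 =
    q , to (yM≐lq _) ∘ y-mono p≤M

  Within : P′.C → Q′.C → Set
  Within p r = Q′.l r ⊆ y p

  abstract
    sup : ∀ p → ∃ λ v → (∀ r → Within p r → r Q′.≤ v) × (∀ u → (∀ r → Within p r → r Q′.≤ u) → v Q′.≤ u)
    sup p = let q , yp⊆lq = y-bounded p in
      Q′.boundedComplete (Within p) (q , λ r lr⊆yp → Q′.l⊆⇒≤ (yp⊆lq ∘ lr⊆yp))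

    t : P′.C → Q′.C
    t p = proj₁ (sup p)

    t-upper : ∀ {p r} → Within p r → r Q′.≤ t p
    t-upper = proj₁ (proj₂ (sup _)) _

    t-least : ∀ {p u} → (∀ r → Within p r → r Q′.≤ u) → t p Q′.≤ u
    t-least = proj₂ (proj₂ (sup _)) _

  t-mono : ∀ {p p'} → p P′.≤ p' → t p Q′.≤ t p'
  t-mono p≤p' = t-least λ r lr⊆yp → t-upper (y-mono p≤p' ∘ lr⊆yp)

  t-col-1 : ∀ {p} → P′.col p ≡ true → Q′.col (t p) ≡ true × y p ≐ Q′.l (t p)
  t-col-1 {p} p∈1 with q , q∈1 , yp≐lq ← y-col-1 p∈1 =
    subst (λ r → Q′.col r ≡ true × y p ≐ Q′.l r) (sym tp≡q) (q∈1 , yp≐lq)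
    where
    tp≡q : t p ≡ q
    tp≡q = Q′.antisym (t-least λ r lr⊆yp → Q′.l⊆⇒≤ (to (yp≐lq _) ∘ lr⊆yp)) (t-upper (from (yp≐lq _)))

  -- Otherwise every r within y p lies strictly below t p, hence below the unique lower cover
  -- of t p; that cover would then be an upper bound smaller than the supremum.
  t-attained : ∀ {p} → Q′.col (t p) ≡ true → Within p (t p)
  t-attained {p} tp∈1 = dne λ not-within →
    let below : ∀ r → Within p r → r Q′.≺ t p
        below r within = t-upper within , λ { refl → not-within within }
        m , _ , m⋖tp = Q′.predecessor-above (below Q′.bot (⊥-elim ∘ Q′.l-bot-empty))
    in proj₂ (proj₁ m⋖tp) (Q′.antisym (proj₁ (proj₁ m⋖tp))
         (t-least λ r within → Q′.lower-cover-of-1-greatest tp∈1 m⋖tp (below r within)))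

  Mismatch : P′.C → Set
  Mismatch p = Q′.col (t p) ≡ true × Within p (t p) × ¬ y p ≐ Q′.l (t p)

  -- φ p is t p when the colours agree; otherwise it is the upper cover of t p, which has
  -- the colour 0 of p (a mismatch forces col p = 0 and col (t p) = 1).
  data Image (p : P′.C) : Q′.C → Set where
    same  : Q′.col (t p) ≡ P′.col p → Image p (t p)
    cover : ∀ {s} → Mismatch p → t p Q′.⋖ s → Q′.col s ≡ P′.col p → Image p s

  image-col : ∀ {p v} → Image p v → Q′.col v ≡ P′.col p
  image-col (same tp∼p) = tp∼p
  image-col (cover _ _ s∼p) = s∼p

  image-above : ∀ {p v} → Image p v → t p Q′.≤ v
  image-above (same _) = Q′.≤-refl
  image-above (cover _ ((tp≤s , _) , _) _) = tp≤s

  mismatch-image : ∀ {p} → P′.col p ≡ false → Q′.col (t p) ≡ true → ∃ (Image p)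
  mismatch-image {p} p∈0 tp∈1 =
    let s , tp⋖s , _ = Q′.successor-below tp≺q
    in s , cover (tp∈1 , attained , y≉) tp⋖s (trans (Q′.upper-cover-of-1-is-0 tp∈1 tp⋖s) (sym p∈0))
    where
    attained : Within p (t p)
    attained = t-attained tp∈1
    y≉ : ¬ y p ≐ Q′.l (t p)
    y≉ yp≐ltp = y-col-0 p∈0 (lift (t p , tp∈1 , yp≐ltp))
    q : Q′.C
    q = proj₁ (y-bounded p)
    tp≺q : t p Q′.≺ q
    tp≺q = t-least (λ r lr⊆yp → Q′.l⊆⇒≤ (proj₂ (y-bounded p) ∘ lr⊆yp)) ,
      λ tp≡q → y≉ λ m → mk⇔ (subst (λ r → Q′.l r m) (sym tp≡q) ∘ proj₂ (y-bounded p)) attained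

  image : ∀ p → ∃ (Image p)
  image p with P′.col p in p∈ | Q′.col (t p) in tp∈
  ... | true  | true  = t p , same (trans tp∈ (sym p∈))
  ... | false | false = t p , same (trans tp∈ (sym p∈))
  ... | true  | false = ⊥-elim (false≢true (trans (sym tp∈) (proj₁ (t-col-1 p∈))))
  ... | false | true  = mismatch-image p∈ tp∈

  image-mono : ∀ {p p' v v'} → p P′.≤ p' → Image p v → Image p' v' → v Q′.≤ v'
  image-mono p≤p' (same _) img' = Q′.≤-trans (t-mono p≤p') (image-above img')
  image-mono {p} {p'} p≤p' (cover (tp∈1 , attained , y≉) tp⋖s _) img' with t p ≟ᶜ t p' | img'
  ... | no tp≢tp' | _ = Q′.≤-trans (Q′.upper-cover-of-1-least tp∈1 tp⋖s (t-mono p≤p' , tp≢tp')) (image-above img')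
  ... | yes tp≡tp' | cover _ tp'⋖s' _ =
    Q′.≤-reflexive (Q′.upper-cover-of-1-unique tp∈1 tp⋖s (subst (Q′._⋖ _) (sym tp≡tp') tp'⋖s'))
  ... | yes tp≡tp' | same tp'∼p' = ⊥-elim (y≉ λ m → mk⇔ yp⊆ltp attained)
    where
    p'∈1 : P′.col p' ≡ true
    p'∈1 = trans (sym tp'∼p') (subst (λ r → Q′.col r ≡ true) tp≡tp' tp∈1)
    yp⊆ltp : y p ⊆ Q′.l (t p)
    yp⊆ltp = subst (λ r → y p ⊆ Q′.l r) (sym tp≡tp') (to (proj₂ (t-col-1 p'∈1) _) ∘ y-mono p≤p')

  homomorphism : NCPoset.cp P ≼c NCPoset.cp Q
  homomorphism = proj₁ ∘ image ,
    (λ p≤p' → image-mono p≤p' (proj₂ (image _)) (proj₂ (image _))) , image-col ∘ proj₂ ∘ image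

theorem26 : ExcludedMiddle 0ℓ → ExcludedMiddle (Level.suc 0ℓ) → ExcludedMiddle (Level.suc (Level.suc 0ℓ)) →
    (P Q : NCPoset) (hP : NCPoset.InLay P) (hQ : NCPoset.InLay Q) →
    Δ⁰₂ (NCPoset.𝒜 P hP) ×
    ((NCPoset.cp P ≼c NCPoset.cp Q) ⇔ (NCPoset.𝒜 P hP ≤w NCPoset.𝒜 Q hQ))
theorem26 em em₁ _ P Q hP hQ =
  Complexity.𝒜-Δ⁰₂ em P hP ,
  mk⇔ (λ (φ , φ-hom) → HomomorphismToReduction.reduction em em₁ P Q hP hQ φ φ-hom)
      (λ (f , f-continuous , f-reduces) → ReductionToHomomorphism.homomorphism em P Q hP hQ f f-continuous f-reduces)
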